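{- For every integer $t$ there is a constant $f_t$ such that the following holds. Let $(G,\preceq)$ be a $t$-mixed free ordered graph and let $v \in V(G)$ satisfy $|\mathrm{prof}(v)| \ge 2t$. Then there are a sequence $(a_1,\ldots,a_t) \in \mathrm{prof}(v)^t$ and a first-order formula $\phi(x, y_1, \ldots, y_t)$ in the language of ordered graphs of length at most $f_t$ such that for all $x \in V(G)$, $(G,\preceq) \models \phi(x, a_1, \ldots, a_t)$ if and only if $x = v$.
   Context: An ordered graph is a finite simple graph $G$ with a total order $\preceq$ on $V(G)$; the language of ordered graphs has symbols $E$ and $\preceq$. Listing $V(G)=\{v_1,\dots,v_n\}$ in $\preceq$-order, $M=M_\preceq(G)$ is the adjacency matrix with $M[i][j]=1$ iff $v_iv_j\in E(G)$; rows and columns are identified with vertices. A matrix is vertical if all rows are equal, horizontal if all columns are equal, mixed if neither; a corner is a $2\times2$ mixed matrix. The corner-profile of column $j$ ($1\le j<n$) is $\mathrm{prof}(j)=\{i\in[n-1] : M[i:(i+1)][j:(j+1)] \text{ is a corner}\}$, where $M[i:i'][j:j']$ is the submatrix on rows $i..i'$ and columns $j..j'$; via the identification, $\mathrm{prof}(v)$ is a set of vertices, and $\mathrm{prof}(J)=\bigcup_{j\in J}\mathrm{prof}(j)$ for a set $J$ of columns. A $t$-mixed minor of $M$ is a partition of the rows into $t$ non-empty intervals and of the columns into $t$ non-empty intervals such that every resulting zone is a mixed submatrix; $(G,\preceq)$ is $t$-mixed free if $M_\preceq(G)$ has no $t$-mixed minor. -}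

module Defs where

open import Data.Nat using (ℕ; zero; suc; _≤_; _<_)
open import Data.Fin using (Fin; zero; suc; toℕ; inject₁; fromℕ)
open import Data.Fin.Subset using (Subset)
open import Data.Bool using (Bool; true; false; not; _∧_; _∨_; _xor_)
open import Data.Maybe using (Maybe; just; nothing)
import Data.Maybe as Maybe
open import Data.Vec using (tabulate)
open import Data.Vec.Functional using (_∷_)
open import Data.Product using (Σ; _×_)
open import Data.Sum using (_⊎_)
open import Data.Empty using (⊥)
open import Relation.Nullary using (¬_)
open import Relation.Binary.PropositionalEquality using (_≡_)

-- An ordered graph on n vertices is represented with
-- vertex set Fin n, the total order ⪯ being the natural order of Fin n
-- (v₁ ⪯ … ⪯ vₙ is the listing 0,1,…,n-1).

record OrderedGraph : Set where
  field
    n      : ℕ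
    adj    : Fin n → Fin n → Bool
    sym    : ∀ i j → adj i j ≡ adj j i
    irrefl : ∀ i → adj i i ≡ false
open OrderedGraph public

Matrix : ℕ → Set
Matrix n = Fin n → Fin n → Bool

matrix : (G : OrderedGraph) → Matrix (n G)
matrix G = adj G

InI : ∀ {n} → ℕ → ℕ → Fin n → Set
InI a b i = (a ≤ toℕ i) × (toℕ i < b)

Vertical : ∀ {n} → Matrix n → ℕ → ℕ → ℕ → ℕ → Set
Vertical M r₁ r₂ c₁ c₂ = ∀ i i' j → InI r₁ r₂ i → InI r₁ r₂ i' → InI c₁ c₂ j →
  M i j ≡ M i' j

Horizontal : ∀ {n} → Matrix n → ℕ → ℕ → ℕ → ℕ → Set
Horizontal M r₁ r₂ c₁ c₂ = ∀ i j j' → InI r₁ r₂ i → InI c₁ c₂ j → InI c₁ c₂ j' →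
  M i j ≡ M i j'

Mixed : ∀ {n} → Matrix n → ℕ → ℕ → ℕ → ℕ → Set
Mixed M r₁ r₂ c₁ c₂ = ¬ Vertical M r₁ r₂ c₁ c₂ × ¬ Horizontal M r₁ r₂ c₁ c₂

record IntervalPartition (t n : ℕ) : Set where
  field
    cut      : Fin (suc t) → ℕ
    cut-zero : cut zero ≡ 0
    cut-last : cut (fromℕ t) ≡ n
    cut-incr : ∀ (k : Fin t) → cut (inject₁ k) < cut (suc k)
open IntervalPartition public

MixedMinor : ∀ {n} → ℕ → Matrix n → Set
MixedMinor {n} t M =
  Σ (IntervalPartition t n) λ R → Σ (IntervalPartition t n) λ C →
    ∀ (a b : Fin t) →
      Mixed M (cut R (inject₁ a)) (cut R (suc a)) (cut C (inject₁ b)) (cut C (suc b))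

MixedFree : ℕ → OrderedGraph → Set
MixedFree t G = ¬ MixedMinor t (matrix G)

next : ∀ {n} → Fin n → Maybe (Fin n)
next {suc zero}    zero    = nothing
next {suc (suc m)} zero    = just (suc zero)
next {suc (suc m)} (suc i) = Maybe.map suc (next i)

eqB : Bool → Bool → Bool
eqB a b = not (a xor b)

-- the 2×2 matrix [[a,b],[c,d]] is a corner (mixed): not vertical
-- (rows equal) and not horizontal (columns equal)
cornerB : Bool → Bool → Bool → Bool → Bool
cornerB a b c d = not (eqB a c ∧ eqB b d) ∧ not (eqB a b ∧ eqB c d)

-- i ∈ prof(j) iff i, j are not last and M[i:(i+1)][j:(j+1)] is a corner
profB : ∀ {n} → Matrix n → Fin n → Fin n → Bool
profB M j i with next i | next j
... | just i' | just j' = cornerB (M i j) (M i j') (M i' j) (M i' j')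
... | _       | _       = false

prof : (G : OrderedGraph) → Fin (n G) → Subset (n G)
prof G v = tabulate (profB (matrix G) v)

-- First-order logic of ordered graphs (symbols E, ⪯, and equality),
-- de Bruijn variables: Formula k has free variables among Fin k.

data Formula : ℕ → Set where
  E    : ∀ {k} → Fin k → Fin k → Formula k
  LE   : ∀ {k} → Fin k → Fin k → Formula k
  EQ   : ∀ {k} → Fin k → Fin k → Formula k
  ⊤f   : ∀ {k} → Formula k
  ⊥f   : ∀ {k} → Formula k
  ¬f   : ∀ {k} → Formula k → Formula k
  _∧f_ : ∀ {k} → Formula k → Formula k → Formula k
  _∨f_ : ∀ {k} → Formula k → Formula k → Formula k
  _⇒f_ : ∀ {k} → Formula k → Formula k → Formula k
  ∃f   : ∀ {k} → Formula (suc k) → Formula k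
  ∀f   : ∀ {k} → Formula (suc k) → Formula k

len : ∀ {k} → Formula k → ℕ
len (E _ _)   = 1
len (LE _ _)  = 1
len (EQ _ _)  = 1
len ⊤f        = 1
len ⊥f        = 1
len (¬f φ)    = suc (len φ)
len (φ ∧f ψ)  = suc (len φ Data.Nat.+ len ψ)
len (φ ∨f ψ)  = suc (len φ Data.Nat.+ len ψ)
len (φ ⇒f ψ)  = suc (len φ Data.Nat.+ len ψ)
len (∃f φ)    = suc (len φ)
len (∀f φ)    = suc (len φ)

Sat : (G : OrderedGraph) → ∀ {k} → Formula k → (Fin k → Fin (n G)) → Set
Sat G (E x y)  ρ = adj G (ρ x) (ρ y) ≡ true
Sat G (LE x y) ρ = toℕ (ρ x) ≤ toℕ (ρ y)
Sat G (EQ x y) ρ = ρ x ≡ ρ y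
Sat G ⊤f       ρ = Data.Unit.⊤ where import Data.Unit
Sat G ⊥f       ρ = ⊥
Sat G (¬f φ)   ρ = ¬ Sat G φ ρ
Sat G (φ ∧f ψ) ρ = Sat G φ ρ × Sat G ψ ρ
Sat G (φ ∨f ψ) ρ = Sat G φ ρ ⊎ Sat G ψ ρ
Sat G (φ ⇒f ψ) ρ = Sat G φ ρ → Sat G ψ ρ
Sat G (∃f φ)   ρ = Σ (Fin (n G)) λ w → Sat G φ (w ∷ ρ)
Sat G (∀f φ)   ρ = ∀ (w : Fin (n G)) → Sat G φ (w ∷ ρ)

{-# OPTIONS --safe #-}
-- Take as parameters every other element of prof(v), so that their rows are spaced by at least
-- two, and let S be the set of vertices whose profile contains all parameters; v ∈ S. Each
-- parameter row has a corner in every column of S, so 2t elements of S, of which again every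
-- other one is used as a column, would give a t-mixed minor. Hence v is the element of index
-- k < 2t of S, and "x is the element of index k of S" is first-order with length bounded in t.
module Submission where

open import Defs hiding (sym)
open import Data.Nat using (ℕ; zero; suc; _+_; _≤_; _<_; _*_; z≤n; s≤s; s≤s⁻¹; _≤?_; _≤′_; ≤′-refl; ≤′-step)
open import Data.Nat.Properties hiding (_≟_)
open import Data.Nat.Induction using (<-wellFounded)
open import Induction.WellFounded using (Acc; acc)
open import Data.Fin using (Fin; zero; suc; toℕ; inject₁; fromℕ<; lift)
open import Data.Fin.Properties using (toℕ-injective; toℕ<n; toℕ-fromℕ; toℕ-fromℕ<; toℕ-inject₁; all?; ∀-cons-⇔)
open import Data.Fin.Subset using (Subset; _∈_; ∣_∣)
open import Data.Bool using (true; false; not; _∧_; _∨_; _≟_)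
open import Data.Maybe using (just; nothing)
import Data.Vec as Vec
open import Data.Vec using (here; there)
open import Data.Vec.Properties using ([]=⇒lookup; lookup∘tabulate)
open import Data.Vec.Functional using (_∷_)
open import Data.Product using (Σ; ∃; _×_; _,_; proj₁; proj₂; map₂)
open import Data.Sum using (_⊎_; inj₁; inj₂)
open import Data.Unit using (tt)
open import Function using (_∘_; _⇔_; mk⇔; Equivalence)
open import Function.Construct.Identity using (⇔-id)
open import Function.Construct.Composition using (_⇔-∘_)
open import Function.Construct.Symmetry using (⇔-sym)
open import Function.Related.TypeIsomorphisms using (→-cong-⇔; ¬-cong-⇔)
open import Data.Product.Function.NonDependent.Propositional using (_×-⇔_)
open import Data.Sum.Function.Propositional using (_⊎-⇔_)
open import Relation.Nullary using (¬_; yes; no; contradiction)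
open import Relation.Nullary.Reflects using (Reflects; ofʸ; ofⁿ; ¬-reflects; _×-reflects_; _⊎-reflects_)
open import Relation.Unary using (Decidable)
open import Relation.Binary.PropositionalEquality

open Equivalence using (to; from)

∃-cong-⇔ : ∀ {A : Set} {P Q : A → Set} → (∀ x → P x ⇔ Q x) → Σ A P ⇔ Σ A Q
∃-cong-⇔ P⇔Q = mk⇔ (map₂ (to (P⇔Q _))) (map₂ (from (P⇔Q _)))

∀-cong-⇔ : ∀ {A : Set} {P Q : A → Set} → (∀ x → P x ⇔ Q x) → (∀ x → P x) ⇔ (∀ x → Q x)
∀-cong-⇔ P⇔Q = mk⇔ (λ p x → to (P⇔Q x) (p x)) (λ q x → from (P⇔Q x) (q x))

reflects⇒⇔≡true : ∀ {P : Set} {b} → Reflects P b → P ⇔ b ≡ true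
reflects⇒⇔≡true (ofʸ p)  = mk⇔ (λ _ → refl) (λ _ → p)
reflects⇒⇔≡true (ofⁿ ¬p) = mk⇔ (λ p → contradiction p ¬p) (λ ())

≡true-reflects : ∀ b → Reflects (b ≡ true) b
≡true-reflects true  = ofʸ refl
≡true-reflects false = ofⁿ (λ ())

next≡just⇔ : ∀ {N} (i i' : Fin N) → next i ≡ just i' ⇔ toℕ i' ≡ suc (toℕ i)
next≡just⇔ i i' = mk⇔ (sound i i') (complete i i')
  where
  sound : ∀ {N} (i i' : Fin N) → next i ≡ just i' → toℕ i' ≡ suc (toℕ i)
  sound {suc zero}    zero    _  ()
  sound {suc (suc _)} zero    ._ refl = refl
  sound {suc (suc _)} (suc i) i' eq with next i in next-i
  sound {suc (suc _)} (suc i) ._ refl | just k = cong suc (sound i k next-i)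
  sound {suc (suc _)} (suc i) _  ()   | nothing

  complete : ∀ {N} (i i' : Fin N) → toℕ i' ≡ suc (toℕ i) → next i ≡ just i'
  complete {suc (suc _)} zero    (suc zero) refl = refl
  complete {suc (suc _)} (suc i) (suc i')   eq   rewrite complete i i' (suc-injective eq) = refl

next≡just⇒< : ∀ {N} {i i' : Fin N} → next i ≡ just i' → suc (toℕ i) < N
next≡just⇒< {i = i} {i'} eq = subst (_< _) (to (next≡just⇔ i i') eq) (toℕ<n i')

profB≡true⇔ : ∀ {N} (M : Matrix N) (j i : Fin N) →
  profB M j i ≡ true ⇔
    Σ (Fin N) λ i' → Σ (Fin N) λ j' → next i ≡ just i' × next j ≡ just j' ×
      cornerB (M i j) (M i j') (M i' j) (M i' j') ≡ true
profB≡true⇔ M j i with next i | next j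
... | just i' | just j' = mk⇔ (λ c → i' , j' , refl , refl , c) λ { (_ , _ , refl , refl , c) → c }
... | just _  | nothing = mk⇔ (λ ()) λ { (_ , _ , _ , () , _) }
... | nothing | _       = mk⇔ (λ ()) λ { (_ , _ , () , _) }

cornerB-equal-rows : ∀ a b → cornerB a b a b ≡ false
cornerB-equal-rows true  true  = refl
cornerB-equal-rows true  false = refl
cornerB-equal-rows false true  = refl
cornerB-equal-rows false false = refl

cornerB-equal-columns : ∀ a c → cornerB a a c c ≡ false
cornerB-equal-columns true  true  = refl
cornerB-equal-columns true  false = refl
cornerB-equal-columns false true  = refl
cornerB-equal-columns false false = refl

eqB-as-∧∨ : ∀ a b → (a ∧ b) ∨ (not a ∧ not b) ≡ eqB a b
eqB-as-∧∨ true  true  = refl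
eqB-as-∧∨ true  false = refl
eqB-as-∧∨ false true  = refl
eqB-as-∧∨ false false = refl

CornerAt : ∀ {N} → Matrix N → ℕ → ℕ → Set
CornerAt {N} M i j =
  Σ (Fin N) λ i₀ → Σ (Fin N) λ j₀ → toℕ i₀ ≡ i × toℕ j₀ ≡ j × profB M j₀ i₀ ≡ true

CornerAt⇒bounded : ∀ {N} {M : Matrix N} {i j} → CornerAt M i j → suc i < N × suc j < N
CornerAt⇒bounded {M = M} (i₀ , j₀ , refl , refl , p) with to (profB≡true⇔ M j₀ i₀) p
... | _ , _ , next-i , next-j , _ = next≡just⇒< next-i , next≡just⇒< next-j

CornerAt⇒Mixed : ∀ {N} {M : Matrix N} {i j r₁ r₂ c₁ c₂} → CornerAt M i j →
  r₁ ≤ i → suc i < r₂ → c₁ ≤ j → suc j < c₂ → Mixed M r₁ r₂ c₁ c₂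
CornerAt⇒Mixed {M = M} {r₁ = r₁} {r₂} {c₁} {c₂} (i , j , refl , refl , p) r₁≤i i<r₂ c₁≤j j<c₂
  with to (profB≡true⇔ M j i) p
... | i' , j' , next-i , next-j , corner = not-vertical , not-horizontal
  where
  open ≡-Reasoning

  pair-in : ∀ {a b} {x x' : Fin _} → next x ≡ just x' → a ≤ toℕ x → suc (toℕ x) < b →
    InI a b x × InI a b x'
  pair-in {x = x} {x'} next-x a≤x x<b =
    (a≤x , <-trans (n<1+n _) x<b) ,
    (subst (_ ≤_) (sym x'≡) (m≤n⇒m≤1+n a≤x) , subst (_< _) (sym x'≡) x<b)
    where
    x'≡ : toℕ x' ≡ suc (toℕ x)
    x'≡ = to (next≡just⇔ x x') next-x

  rows : InI r₁ r₂ i × InI r₁ r₂ i'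
  rows = pair-in next-i r₁≤i i<r₂

  cols : InI c₁ c₂ j × InI c₁ c₂ j'
  cols = pair-in next-j c₁≤j j<c₂

  not-vertical : ¬ Vertical M r₁ r₂ c₁ c₂
  not-vertical V = contradiction (begin
    true                                          ≡⟨ corner ⟨
    cornerB (M i j) (M i j') (M i' j) (M i' j')   ≡⟨ cong₂ (cornerB (M i j) (M i j'))
                                                       (V i i' j (proj₁ rows) (proj₂ rows) (proj₁ cols))
                                                       (V i i' j' (proj₁ rows) (proj₂ rows) (proj₂ cols)) ⟨
    cornerB (M i j) (M i j') (M i j) (M i j')     ≡⟨ cornerB-equal-rows (M i j) (M i j') ⟩
    false                                         ∎) λ ()

  not-horizontal : ¬ Horizontal M r₁ r₂ c₁ c₂
  not-horizontal H = contradiction (begin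
    true                                          ≡⟨ corner ⟨
    cornerB (M i j) (M i j') (M i' j) (M i' j')   ≡⟨ cong₂ (λ b d → cornerB (M i j) b (M i' j) d)
                                                       (H i j j' (proj₁ rows) (proj₁ cols) (proj₂ cols))
                                                       (H i' j j' (proj₂ rows) (proj₁ cols) (proj₂ cols)) ⟨
    cornerB (M i j) (M i j) (M i' j) (M i' j)     ≡⟨ cornerB-equal-columns (M i j) (M i' j) ⟩
    false                                         ∎) λ ()

Spaced : ℕ → (ℕ → ℕ) → Set
Spaced t r = ∀ l → suc l < t → suc (suc (r l)) ≤ r (suc l)

module _ (N : ℕ) (r : ℕ → ℕ) where

  -- the l-th zone of rows is [boundary t l, boundary t (suc l)); it contains r l and r l + 1
  boundary : ℕ → ℕ → ℕ
  boundary t zero = 0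
  boundary t (suc l) with t ≤? suc l
  ... | yes _ = N
  ... | no  _ = r (suc l)

  boundary≤ : ∀ {t} l → l < t → boundary t l ≤ r l
  boundary≤ zero _ = z≤n
  boundary≤ {t} (suc l) l<t with t ≤? suc l
  ... | yes t≤l = contradiction l<t (≤⇒≯ t≤l)
  ... | no  _   = ≤-refl

  <boundary : ∀ {t} → Spaced t r → ∀ l → l < t → suc (r l) < N → suc (r l) < boundary t (suc l)
  <boundary {t} spaced l l<t rl<N with t ≤? suc l
  ... | yes _   = rl<N
  ... | no  t≰l = spaced l (≰⇒> t≰l)

  boundary-last : ∀ t → boundary (suc t) (suc t) ≡ N
  boundary-last t with suc t ≤? suc t
  ... | yes _ = refl
  ... | no  ≰ = contradiction ≤-refl ≰

  spacedPartition : ∀ {t} → 1 ≤ t → Spaced t r → (∀ (k : Fin t) → suc (r (toℕ k)) < N) →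
    IntervalPartition t N
  spacedPartition {suc t} _ spaced bounded = record
    { cut      = boundary (suc t) ∘ toℕ
    ; cut-zero = refl
    ; cut-last = trans (cong (boundary (suc t)) (toℕ-fromℕ (suc t))) (boundary-last t)
    ; cut-incr = λ k → subst (λ l → boundary (suc t) l < boundary (suc t) (suc (toℕ k)))
        (sym (toℕ-inject₁ k))
        (≤-<-trans (boundary≤ (toℕ k) (toℕ<n k))
          (<-trans (n<1+n _) (<boundary spaced (toℕ k) (toℕ<n k) (bounded k))))
    }

spacedCorners⇒MixedMinor : ∀ {N t} (M : Matrix N) (r c : ℕ → ℕ) → 1 ≤ t →
  Spaced t r → Spaced t c → (∀ (k l : Fin t) → CornerAt M (r (toℕ k)) (c (toℕ l))) →
  MixedMinor t M
spacedCorners⇒MixedMinor {N} {suc t} M r c 1≤t r-spaced c-spaced corner =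
  spacedPartition N r 1≤t r-spaced (λ k → proj₁ (CornerAt⇒bounded (corner k k))) ,
  spacedPartition N c 1≤t c-spaced (λ l → proj₂ (CornerAt⇒bounded (corner l l))) ,
  zone
  where
  zone : ∀ (k l : Fin (suc t)) →
    Mixed M (boundary N r (suc t) (toℕ (inject₁ k))) (boundary N r (suc t) (suc (toℕ k)))
            (boundary N c (suc t) (toℕ (inject₁ l))) (boundary N c (suc t) (suc (toℕ l)))
  zone k l rewrite toℕ-inject₁ k | toℕ-inject₁ l =
    CornerAt⇒Mixed (corner k l)
      (boundary≤ N r (toℕ k) (toℕ<n k))
      (<boundary N r r-spaced (toℕ k) (toℕ<n k) (proj₁ (CornerAt⇒bounded (corner k k))))
      (boundary≤ N c (toℕ l) (toℕ<n l))
      (<boundary N c c-spaced (toℕ l) (toℕ<n l) (proj₂ (CornerAt⇒bounded (corner l l))))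

IncreasingOn : ℕ → (ℕ → ℕ) → Set
IncreasingOn m s = ∀ i → suc i < m → s i < s (suc i)

evens-spaced : ∀ {m t s} → IncreasingOn m s → 2 * t ≤ m → Spaced t (λ l → s (2 * l))
evens-spaced {m} {t} {s} increasing 2t≤m l 1+l<t rewrite *-suc 2 l =
  ≤-trans (s≤s (increasing (2 * l) (<-trans (n<1+n _) 2+2l<m))) (increasing (suc (2 * l)) 2+2l<m)
  where
  2+2l<m : 2 + 2 * l < m
  2+2l<m = <-≤-trans (subst (_< 2 * t) (*-suc 2 l) (*-monoʳ-< 2 1+l<t)) 2t≤m

record Enumeration {N} (p : Subset N) (m : ℕ) : Set where
  field
    position   : ℕ → ℕ
    increasing : IncreasingOn m position
    member     : ∀ k → k < m → Σ (Fin N) λ i → toℕ i ≡ position k × i ∈ p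

module _ {N} {p : Subset N} where
  open Enumeration

  enumeration-skip : ∀ {m b} → Enumeration p m → Enumeration (b Vec.∷ p) m
  enumeration-skip e = record
    { position   = suc ∘ position e
    ; increasing = λ i i<m → s≤s (increasing e i i<m)
    ; member     = λ k k<m → let (i , i≡ , i∈p) = member e k k<m in suc i , cong suc i≡ , there i∈p
    }

  enumeration-take : ∀ {m} → Enumeration p m → Enumeration (true Vec.∷ p) (suc m)
  enumeration-take {m} e = record
    { position   = position′
    ; increasing = increasing′
    ; member     = member′
    }
    where
    position′ : ℕ → ℕ
    position′ zero    = 0
    position′ (suc k) = suc (position e k)

    increasing′ : IncreasingOn (suc m) position′
    increasing′ zero    _          = s≤s z≤n
    increasing′ (suc i) (s≤s i<m) = s≤s (increasing e i i<m)

    member′ : ∀ k → k < suc m → Σ (Fin (suc N)) λ i → toℕ i ≡ position′ k × i ∈ (true Vec.∷ p)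
    member′ zero    _         = zero , refl , here
    member′ (suc k) (s≤s k<m) = let (i , i≡ , i∈p) = member e k k<m in suc i , cong suc i≡ , there i∈p

enumerate : ∀ {N} (p : Subset N) m → m ≤ ∣ p ∣ → Enumeration p m
enumerate p               zero    _       = record { position = λ _ → 0 ; increasing = λ _ () ; member = λ _ () }
enumerate (true Vec.∷ p)  (suc m) (s≤s h) = enumeration-take (enumerate p m h)
enumerate (false Vec.∷ p) (suc m) h       = enumeration-skip (enumerate p (suc m) h)

data Nth {N} (S : Fin N → Set) : ℕ → Fin N → Set where
  first : ∀ {x} → S x → (∀ z → S z → toℕ x ≤ toℕ z) → Nth S zero x
  after : ∀ {k x y} → S x → Nth S k y → toℕ y < toℕ x →
          (∀ z → S z → toℕ y < toℕ z → toℕ x ≤ toℕ z) → Nth S (suc k) x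

module _ {N} {S : Fin N → Set} where

  Nth-unique : ∀ {k x x'} → Nth S k x → Nth S k x' → x ≡ x'
  Nth-unique (first Sx least) (first Sx' least') =
    toℕ-injective (≤-antisym (least _ Sx') (least' _ Sx))
  Nth-unique (after Sx y-nth y<x least) (after Sx' y'-nth y'<x' least')
    with refl ← Nth-unique y-nth y'-nth =
    toℕ-injective (≤-antisym (least _ Sx' y'<x') (least' _ Sx y<x))

  GreatestBelow : ℕ → Fin N → Set
  GreatestBelow b y = S y × toℕ y < b × (∀ z → S z → toℕ y < toℕ z → b ≤ toℕ z)

  NoneBelow : ℕ → Set
  NoneBelow b = ∀ z → S z → b ≤ toℕ z

  ∉⇒≢ : ∀ {b} .(b<N : b < N) → ¬ S (fromℕ< b<N) → ∀ z → S z → b ≢ toℕ z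
  ∉⇒≢ b<N ¬Sb z Sz b≡z = ¬Sb (subst S (sym (toℕ-injective (trans (toℕ-fromℕ< b<N) b≡z))) Sz)

  greatestBelow? : Decidable S → ∀ b → b ≤ N → ∃ (GreatestBelow b) ⊎ NoneBelow b
  greatestBelow? S? zero    _   = inj₂ (λ _ _ → z≤n)
  greatestBelow? S? (suc b) b<N with S? (fromℕ< b<N)
  ... | yes Sb = inj₁ (fromℕ< b<N , Sb , ≤-reflexive (cong suc b≡) , λ z _ b<z → subst (_< toℕ z) b≡ b<z)
    where
    b≡ : toℕ (fromℕ< b<N) ≡ b
    b≡ = toℕ-fromℕ< b<N
  ... | no ¬Sb with greatestBelow? S? b (<⇒≤ b<N)
  ...   | inj₁ (y , Sy , y<b , tight) =
          inj₁ (y , Sy , m≤n⇒m≤1+n y<b , λ z Sz y<z → ≤∧≢⇒< (tight z Sz y<z) (∉⇒≢ b<N ¬Sb z Sz))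
  ...   | inj₂ none = inj₂ (λ z Sz → ≤∧≢⇒< (none z Sz) (∉⇒≢ b<N ¬Sb z Sz))

  Nth-exists : Decidable S → ∀ {x} → S x → ∃ λ k → Nth S k x
  Nth-exists S? Sx = go (<-wellFounded _) Sx
    where
    go : ∀ {x} → Acc _<_ (toℕ x) → S x → ∃ λ k → Nth S k x
    go {x} (acc below) Sx with greatestBelow? S? (toℕ x) (<⇒≤ (toℕ<n x))
    ... | inj₂ none = zero , first Sx none
    ... | inj₁ (y , Sy , y<x , tight) =
      let (k , y-nth) = go (below y<x) Sy in suc k , after Sx y-nth y<x tight

  -- element x-nth i is the element of index i of S for i ≤ k, and x for larger i
  element : ∀ {k x} → Nth S k x → ℕ → Fin N
  element {x = x} (first _ _) _ = x
  element {suc k} {x} (after _ y-nth _ _) i with i ≤? k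
  ... | yes _ = element y-nth i
  ... | no  _ = x

  element-∈ : ∀ {k x} (x-nth : Nth S k x) i → S (element x-nth i)
  element-∈ (first Sx _) _ = Sx
  element-∈ {suc k} (after Sx y-nth _ _) i with i ≤? k
  ... | yes _ = element-∈ y-nth i
  ... | no  _ = Sx

  element-last : ∀ {k x} (x-nth : Nth S k x) → element x-nth k ≡ x
  element-last (first _ _) = refl
  element-last {suc k} (after _ _ _ _) with suc k ≤? k
  ... | yes 1+k≤k = contradiction 1+k≤k (<-irrefl refl)
  ... | no  _   = refl

  element-increasing : ∀ {k x} (x-nth : Nth S k x) → IncreasingOn (suc k) (toℕ ∘ element x-nth)
  element-increasing (first _ _) _ (s≤s ())
  element-increasing {suc k} {x} (after {y = y} _ y-nth y<x _) i 2+i≤2+k with i ≤? k | suc i ≤? k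
  ... | no  i≰k | _         = contradiction (s≤s⁻¹ (s≤s⁻¹ 2+i≤2+k)) i≰k
  ... | yes _   | yes 1+i≤k = element-increasing y-nth i (s≤s 1+i≤k)
  ... | yes i≤k | no  1+i≰k = subst (λ w → toℕ w < toℕ x) (sym y≡) y<x
    where
    y≡ : element y-nth i ≡ y
    y≡ = trans (cong (element y-nth) (≤-antisym i≤k (s≤s⁻¹ (≰⇒> 1+i≰k)))) (element-last y-nth)

Nth-bound : ∀ {t} (G : OrderedGraph) {S : Fin (n G) → Set} (r : ℕ → ℕ) → 1 ≤ t → MixedFree t G →
  Spaced t r → (∀ {w} → S w → ∀ (k : Fin t) → CornerAt (adj G) (r (toℕ k)) (toℕ w)) →
  ∀ {k x} → Nth S k x → suc k < 2 * t
Nth-bound {t} G r 1≤t free r-spaced corner {k} x-nth with 2 * t ≤? suc k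
... | no  2t≰1+k = ≰⇒> 2t≰1+k
... | yes 2t≤1+k = contradiction
  (spacedCorners⇒MixedMinor (adj G) r (λ l → toℕ (element x-nth (2 * l))) 1≤t
    r-spaced (evens-spaced (element-increasing x-nth) 2t≤1+k)
    (λ k l → corner (element-∈ x-nth (2 * toℕ l)) k))
  free

rename : ∀ {m m'} → (Fin m → Fin m') → Formula m → Formula m'
rename π (E x y)  = E (π x) (π y)
rename π (LE x y) = LE (π x) (π y)
rename π (EQ x y) = EQ (π x) (π y)
rename π ⊤f       = ⊤f
rename π ⊥f       = ⊥f
rename π (¬f φ)   = ¬f (rename π φ)
rename π (φ ∧f ψ) = rename π φ ∧f rename π ψ
rename π (φ ∨f ψ) = rename π φ ∨f rename π ψ
rename π (φ ⇒f ψ) = rename π φ ⇒f rename π ψ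
rename π (∃f φ)   = ∃f (rename (lift 1 π) φ)
rename π (∀f φ)   = ∀f (rename (lift 1 π) φ)

len-rename : ∀ {m m'} (π : Fin m → Fin m') φ → len (rename π φ) ≡ len φ
len-rename π (E x y)  = refl
len-rename π (LE x y) = refl
len-rename π (EQ x y) = refl
len-rename π ⊤f       = refl
len-rename π ⊥f       = refl
len-rename π (¬f φ)   = cong suc (len-rename π φ)
len-rename π (φ ∧f ψ) = cong₂ (λ a b → suc (a + b)) (len-rename π φ) (len-rename π ψ)
len-rename π (φ ∨f ψ) = cong₂ (λ a b → suc (a + b)) (len-rename π φ) (len-rename π ψ)
len-rename π (φ ⇒f ψ) = cong₂ (λ a b → suc (a + b)) (len-rename π φ) (len-rename π ψ)
len-rename π (∃f φ)   = cong suc (len-rename (lift 1 π) φ)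
len-rename π (∀f φ)   = cong suc (len-rename (lift 1 π) φ)

-- a fresh variable at position 1; variable 0 is kept
weaken₁ : ∀ {m} → Formula (suc m) → Formula (suc (suc m))
weaken₁ = rename (lift 1 suc)

LTf : ∀ {m} → Fin m → Fin m → Formula m
LTf u w = ¬f (LE w u)

succF : ∀ {m} → Fin m → Fin m → Formula m
succF u w = LTf u w ∧f ∀f (LTf (suc u) zero ⇒f LE (suc w) zero)

eqF : ∀ {m} → Formula m → Formula m → Formula m
eqF φ ψ = (φ ∧f ψ) ∨f (¬f φ ∧f ¬f ψ)

cornerF : ∀ {m} → Formula m → Formula m → Formula m → Formula m → Formula m
cornerF A B C D = ¬f (eqF A C ∧f eqF B D) ∧f ¬f (eqF A B ∧f eqF C D)

profF : ∀ {m} → Fin m → Fin m → Formula m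
profF {m} u v = ∃f (∃f (succF u″ (suc zero) ∧f (succF v″ zero ∧f
  cornerF (E u″ v″) (E u″ zero) (E (suc zero) v″) (E (suc zero) zero))))
  where
  u″ v″ : Fin (suc (suc m))
  u″ = suc (suc u)
  v″ = suc (suc v)

⋀ : ∀ {m t} → (Fin t → Formula m) → Formula m
⋀ {t = zero}  _ = ⊤f
⋀ {t = suc t} φ = φ zero ∧f ⋀ (φ ∘ suc)

commonProfileF : ∀ t → Formula (suc t)
commonProfileF t = ⋀ λ k → profF (suc k) zero

nthF : ∀ {p} → Formula (suc p) → ℕ → Formula (suc p)
nthF σ zero    = σ ∧f ∀f (weaken₁ σ ⇒f LE (suc zero) zero)
nthF σ (suc k) = σ ∧f ∃f (weaken₁ (nthF σ k) ∧f (LTf zero (suc zero) ∧f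
  ∀f ((weaken₁ (weaken₁ σ) ∧f LTf (suc zero) zero) ⇒f LE (suc (suc zero)) zero)))

lift-≡ : ∀ {A : Set} {m m'} {π : Fin m → Fin m'} {ρ' : Fin m' → A} {ρ} w →
  (∀ i → ρ' (π i) ≡ ρ i) → ∀ i → (w ∷ ρ') (lift 1 π i) ≡ (w ∷ ρ) i
lift-≡ w _     zero    = refl
lift-≡ w ρ'π≡ρ (suc i) = ρ'π≡ρ i

module _ (G : OrderedGraph) where

  Sat-rename : ∀ {m m'} (φ : Formula m) {π : Fin m → Fin m'} {ρ' ρ} → (∀ i → ρ' (π i) ≡ ρ i) →
    Sat G (rename π φ) ρ' ⇔ Sat G φ ρ
  Sat-rename (E x y)  ρ'π≡ρ rewrite ρ'π≡ρ x | ρ'π≡ρ y = ⇔-id _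
  Sat-rename (LE x y) ρ'π≡ρ rewrite ρ'π≡ρ x | ρ'π≡ρ y = ⇔-id _
  Sat-rename (EQ x y) ρ'π≡ρ rewrite ρ'π≡ρ x | ρ'π≡ρ y = ⇔-id _
  Sat-rename ⊤f       _     = ⇔-id _
  Sat-rename ⊥f       _     = ⇔-id _
  Sat-rename (¬f φ)   ρ'π≡ρ = ¬-cong-⇔ (Sat-rename φ ρ'π≡ρ)
  Sat-rename (φ ∧f ψ) ρ'π≡ρ = Sat-rename φ ρ'π≡ρ ×-⇔ Sat-rename ψ ρ'π≡ρ
  Sat-rename (φ ∨f ψ) ρ'π≡ρ = Sat-rename φ ρ'π≡ρ ⊎-⇔ Sat-rename ψ ρ'π≡ρ
  Sat-rename (φ ⇒f ψ) ρ'π≡ρ = →-cong-⇔ (Sat-rename φ ρ'π≡ρ) (Sat-rename ψ ρ'π≡ρ)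
  Sat-rename (∃f φ)   ρ'π≡ρ = ∃-cong-⇔ λ w → Sat-rename φ (lift-≡ w ρ'π≡ρ)
  Sat-rename (∀f φ)   ρ'π≡ρ = ∀-cong-⇔ λ w → Sat-rename φ (lift-≡ w ρ'π≡ρ)

  Sat-weaken₁ : ∀ {m} (φ : Formula (suc m)) {z y ρ} → Sat G (weaken₁ φ) (z ∷ y ∷ ρ) ⇔ Sat G φ (z ∷ ρ)
  Sat-weaken₁ φ = Sat-rename φ λ { zero → refl ; (suc _) → refl }

  Sat-succF : ∀ {m} (u w : Fin m) {ρ} → Sat G (succF u w) ρ ⇔ next (ρ u) ≡ just (ρ w)
  Sat-succF u w {ρ} = ⇔-sym (next≡just⇔ (ρ u) (ρ w)) ⇔-∘ mk⇔ sound complete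
    where
    sound : Sat G (succF u w) ρ → toℕ (ρ w) ≡ suc (toℕ (ρ u))
    sound (w≰u , least) = ≤-antisym w≤1+u (≰⇒> w≰u)
      where
      1+u<N : suc (toℕ (ρ u)) < n G
      1+u<N = ≤-<-trans (≰⇒> w≰u) (toℕ<n (ρ w))
      w≤1+u : toℕ (ρ w) ≤ suc (toℕ (ρ u))
      w≤1+u = subst (toℕ (ρ w) ≤_) (toℕ-fromℕ< 1+u<N)
        (least (fromℕ< 1+u<N) (<⇒≱ (≤-reflexive (sym (toℕ-fromℕ< 1+u<N)))))

    complete : toℕ (ρ w) ≡ suc (toℕ (ρ u)) → Sat G (succF u w) ρ
    complete w≡1+u = <⇒≱ (≤-reflexive (sym w≡1+u)) ,
      λ z z≰u → subst (_≤ toℕ z) (sym w≡1+u) (≰⇒> z≰u)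

  eqF-reflects : ∀ {m} {φ ψ : Formula m} {ρ a b} → Reflects (Sat G φ ρ) a → Reflects (Sat G ψ ρ) b →
    Reflects (Sat G (eqF φ ψ) ρ) (eqB a b)
  eqF-reflects {a = a} {b} φ-reflects ψ-reflects = subst (Reflects _) (eqB-as-∧∨ a b)
    ((φ-reflects ×-reflects ψ-reflects) ⊎-reflects (¬-reflects φ-reflects ×-reflects ¬-reflects ψ-reflects))

  cornerF-reflects : ∀ {m} {A B C D : Formula m} {ρ a b c d} →
    Reflects (Sat G A ρ) a → Reflects (Sat G B ρ) b → Reflects (Sat G C ρ) c → Reflects (Sat G D ρ) d →
    Reflects (Sat G (cornerF A B C D) ρ) (cornerB a b c d)
  cornerF-reflects A-r B-r C-r D-r =
    ¬-reflects (eqF-reflects A-r C-r ×-reflects eqF-reflects B-r D-r) ×-reflects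
    ¬-reflects (eqF-reflects A-r B-r ×-reflects eqF-reflects C-r D-r)

  Sat-cornerF-E : ∀ {m} (i i' j j' : Fin m) {ρ} →
    Sat G (cornerF (E i j) (E i j') (E i' j) (E i' j')) ρ ⇔
      cornerB (adj G (ρ i) (ρ j)) (adj G (ρ i) (ρ j')) (adj G (ρ i') (ρ j)) (adj G (ρ i') (ρ j')) ≡ true
  Sat-cornerF-E i i' j j' = reflects⇒⇔≡true (cornerF-reflects {A = E i j} {E i j'} {E i' j} {E i' j'}
    (≡true-reflects _) (≡true-reflects _) (≡true-reflects _) (≡true-reflects _))

  Sat-profF : ∀ {m} (u v : Fin m) {ρ} → Sat G (profF u v) ρ ⇔ profB (adj G) (ρ v) (ρ u) ≡ true
  Sat-profF u v {ρ} = ⇔-sym (profB≡true⇔ (adj G) (ρ v) (ρ u)) ⇔-∘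
    ∃-cong-⇔ λ i' → ∃-cong-⇔ λ j' → let ρ′ = j' ∷ i' ∷ ρ in
      Sat-succF (suc (suc u)) (suc zero) {ρ′} ×-⇔ (Sat-succF (suc (suc v)) zero {ρ′} ×-⇔
      Sat-cornerF-E (suc (suc u)) (suc zero) (suc (suc v)) zero {ρ′})

  Sat-⋀ : ∀ {m t} (φ : Fin t → Formula m) {ρ} → Sat G (⋀ φ) ρ ⇔ (∀ k → Sat G (φ k) ρ)
  Sat-⋀ {t = zero}  φ = mk⇔ (λ _ ()) (λ _ → tt)
  Sat-⋀ {t = suc t} φ = ∀-cons-⇔ ⇔-∘ (⇔-id _ ×-⇔ Sat-⋀ (φ ∘ suc))

  CommonProfile : ∀ {t} → (Fin t → Fin (n G)) → Fin (n G) → Set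
  CommonProfile a w = ∀ k → profB (adj G) w (a k) ≡ true

  commonProfile? : ∀ {t} (a : Fin t → Fin (n G)) → Decidable (CommonProfile a)
  commonProfile? a w = all? λ k → profB (adj G) w (a k) ≟ true

  Sat-commonProfileF : ∀ {t} (a : Fin t → Fin (n G)) w →
    Sat G (commonProfileF t) (w ∷ a) ⇔ CommonProfile a w
  Sat-commonProfileF a w =
    ∀-cong-⇔ (λ k → Sat-profF (suc k) zero {w ∷ a}) ⇔-∘ Sat-⋀ (λ k → profF (suc k) zero)

  module _ {p} {σ : Formula (suc p)} {a : Fin p → Fin (n G)} {S : Fin (n G) → Set}
           (σ-defines : ∀ w → Sat G σ (w ∷ a) ⇔ S w) where

    Sat-nthF : ∀ k x → Sat G (nthF σ k) (x ∷ a) ⇔ Nth S k x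
    Sat-nthF zero x = mk⇔
      (λ (σx , least) → first (to (σ-defines x) σx) λ z Sz → least z (from σ₁ Sz))
      (λ { (first Sx least) → from (σ-defines x) Sx , λ z σz → least z (to σ₁ σz) })
      where
      σ₁ : ∀ {z} → Sat G (weaken₁ σ) (z ∷ x ∷ a) ⇔ S z
      σ₁ = σ-defines _ ⇔-∘ Sat-weaken₁ σ
    Sat-nthF (suc k) x = mk⇔ sound complete
      where
      σ₂ : ∀ {z y} → Sat G (weaken₁ (weaken₁ σ)) (z ∷ y ∷ x ∷ a) ⇔ S z
      σ₂ = (σ-defines _ ⇔-∘ Sat-weaken₁ σ) ⇔-∘ Sat-weaken₁ (weaken₁ σ)

      nth₁ : ∀ {y} → Sat G (weaken₁ (nthF σ k)) (y ∷ x ∷ a) ⇔ Nth S k y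
      nth₁ = Sat-nthF k _ ⇔-∘ Sat-weaken₁ (nthF σ k)

      sound : Sat G (nthF σ (suc k)) (x ∷ a) → Nth S (suc k) x
      sound (σx , y , y-nth , x≰y , least) =
        after (to (σ-defines x) σx) (to nth₁ y-nth) (≰⇒> x≰y)
          λ z Sz y<z → least z (from σ₂ Sz , <⇒≱ y<z)

      complete : Nth S (suc k) x → Sat G (nthF σ (suc k)) (x ∷ a)
      complete (after {y = y} Sx y-nth y<x least) =
        from (σ-defines x) Sx , y , from nth₁ y-nth , <⇒≱ y<x ,
          λ z (σz , z≰y) → least z (to σ₂ σz) (≰⇒> z≰y)

stepwise⇒monotone : (f : ℕ → ℕ) → (∀ k → f k ≤ f (suc k)) → ∀ {k K} → k ≤ K → f k ≤ f K
stepwise⇒monotone f step k≤K = go (≤⇒≤′ k≤K)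
  where
  go : ∀ {k K} → k ≤′ K → f k ≤ f K
  go ≤′-refl       = ≤-refl
  go (≤′-step k≤K) = ≤-trans (go k≤K) (step _)

len-nthF-mono : ∀ {p} (σ : Formula (suc p)) {k K} → k ≤ K → len (nthF σ k) ≤ len (nthF σ K)
len-nthF-mono σ = stepwise⇒monotone (len ∘ nthF σ) step
  where
  step : ∀ k → len (nthF σ k) ≤ len (nthF σ (suc k))
  step k = ≤-trans (≤-reflexive (sym (len-rename (lift 1 suc) (nthF σ k))))
    (≤-trans (m≤m+n _ _) (≤-trans (m≤n+m _ 2) (≤-trans (m≤n+m _ (len σ)) (n≤1+n _))))

∈prof⇒profB : ∀ (G : OrderedGraph) {v i} → i ∈ prof G v → profB (adj G) v i ≡ true
∈prof⇒profB G {v} {i} i∈ = trans (sym (lookup∘tabulate (profB (adj G) v) i)) ([]=⇒lookup i∈)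

vertex-definable-from-profile : ∀ {t} → 1 ≤ t → ∀ (G : OrderedGraph) → MixedFree t G →
  ∀ (v : Fin (n G)) → 2 * t ≤ ∣ prof G v ∣ →
  Σ (Fin t → Fin (n G)) λ a → (∀ k → a k ∈ prof G v) ×
    Σ (Formula (suc t)) λ φ → (len φ ≤ len (nthF (commonProfileF t) (2 * t))) ×
      (∀ (x : Fin (n G)) → (Sat G φ (x ∷ a) → x ≡ v) × (x ≡ v → Sat G φ (x ∷ a)))
vertex-definable-from-profile {t} 1≤t G free v 2t≤∣prof∣ =
  a , a∈prof , nthF σ k , len-nthF-mono σ k≤2t ,
  λ x → (λ φx → Nth-unique (to (Sat-nthF G σ-defines k x) φx) v-nth) ,
        λ { refl → from (Sat-nthF G σ-defines k v) v-nth }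
  where
  open Enumeration (enumerate (prof G v) (2 * t) 2t≤∣prof∣)

  pick : ∀ (k : Fin t) → Σ (Fin (n G)) λ i → toℕ i ≡ position (2 * toℕ k) × i ∈ prof G v
  pick k = member (2 * toℕ k) (*-monoʳ-< 2 (toℕ<n k))

  a : Fin t → Fin (n G)
  a = proj₁ ∘ pick

  a∈prof : ∀ k → a k ∈ prof G v
  a∈prof = proj₂ ∘ proj₂ ∘ pick

  σ : Formula (suc t)
  σ = commonProfileF t

  σ-defines : ∀ w → Sat G σ (w ∷ a) ⇔ CommonProfile G a w
  σ-defines = Sat-commonProfileF G a

  corners : ∀ {w} → CommonProfile G a w → ∀ k → CornerAt (adj G) (position (2 * toℕ k)) (toℕ w)
  corners {w} a∈prof-w k = a k , w , proj₁ (proj₂ (pick k)) , refl , a∈prof-w k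

  rank : ∃ λ k → Nth (CommonProfile G a) k v
  rank = Nth-exists (commonProfile? G a) (∈prof⇒profB G ∘ a∈prof)

  k : ℕ
  k = proj₁ rank

  v-nth : Nth (CommonProfile G a) k v
  v-nth = proj₂ rank

  k≤2t : k ≤ 2 * t
  k≤2t = <⇒≤ (<-trans (n<1+n k)
    (Nth-bound G (λ l → position (2 * l)) 1≤t free (evens-spaced increasing ≤-refl) corners v-nth))

proposition1 : ∀ (t : ℕ) → 1 ≤ t →
    Σ ℕ λ f →
      ∀ (G : OrderedGraph) → MixedFree t G →
      ∀ (v : Fin (n G)) → 2 * t ≤ ∣ prof G v ∣ →
      Σ (Fin t → Fin (n G)) λ a → (∀ k → a k ∈ prof G v) ×
        Σ (Formula (suc t)) λ φ → (len φ ≤ f) ×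
          (∀ (x : Fin (n G)) → (Sat G φ (x ∷ a) → x ≡ v) × (x ≡ v → Sat G φ (x ∷ a)))
proposition1 t 1≤t = len (nthF (commonProfileF t) (2 * t)) , vertex-definable-from-profile 1≤t
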